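{- Let $(x_n^t)_{n\in\mathbb{Z},\,t\ge 0}$ be the rule 150 elementary cellular automaton started from a single seed, i.e. $x_n^0=1$ if $n=0$ and $x_n^0=0$ otherwise, and $x_n^{t+1}=(x_{n-1}^t+x_n^t+x_{n+1}^t)\bmod 2$ for all $n\in\mathbb{Z}$, $t\ge 0$. Let $X(t)=\sum_{n\in\mathbb{Z}} x_n^t$ be the total activity at time $t$. Then for every integer $n\ge 1$ and every integer $s$ with $0\le s<2^{n-1}$, $$X(2^n+s)=3\,X(s),\qquad X(2^n+2^{n-1}+s)=X(2^{n-1}+s)+2\,X(s).$$ Equivalently: define vectors $A_0=(1)$, $B_0=(3)$ and, for $n\ge1$, $A_n=(A_{n-1},B_{n-1})$ (concatenation) and $B_n=(3A_{n-1},\,2A_{n-1}+B_{n-1})$ (concatenation, with scalar multiples and sums taken componentwise, both $A_{n-1},B_{n-1}$ having length $2^{n-1}$); then for every $n\ge 0$ the concatenation $(A_n,B_n)$ equals $(X(0),X(1),\dots,X(2^{n+1}-1))$.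
   Context: $X(t)$ is finite for each $t$ since only finitely many cells are nonzero at each time. -}

module Defs where

open import Data.Nat using (ℕ; zero; suc; _+_)
open import Data.Integer as ℤ using (ℤ; +_; -[1+_])
open import Data.Bool using (Bool; true; false; _xor_; if_then_else_)
open import Relation.Nullary.Decidable using (does)

cell : ℕ → ℤ → Bool
cell zero    n = does (n ℤ.≟ + 0)
cell (suc t) n = cell t (n ℤ.- + 1) xor cell t n xor cell t (n ℤ.+ + 1)

bit : Bool → ℕ
bit true  = 1
bit false = 0

windowSum : ℕ → ℕ → ℕ
windowSum t zero    = bit (cell t (+ 0))
windowSum t (suc k) = bit (cell t -[1+ k ]) + windowSum t k + bit (cell t (+ suc k))

-- Total activity X(t) = Σ_{n ∈ ℤ} x_n^t.  At time t only cells with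
-- |n| ≤ t can be nonzero (light cone of the seed), so the sum over ℤ
-- equals the finite sum over the window [-t, t].
X : ℕ → ℕ
X t = windowSum t t

-- Rule 150 is linear over GF(2), so by the freshman's dream 2^k steps act as
-- x ↦ x(· - 2^k) + x + x(· + 2^k).  Let d = 2^m, s < d, let f be the
-- configuration at time s, which lives in [-s, s], and let fᵢ be f translated
-- by i·d.  Translates at distance ≥ 2d are disjoint, so the configuration at
-- time 2d + s is f₋₂ + f₀ + f₂ with disjoint summands, whence X(2d+s) = 3X(s).
-- At time d + s it is f₋₁ + f₀ + f₁, and at time 3d + s it is
-- (f₋₃ + f₋₂) + f₀ + (f₂ + f₃) with disjoint blocks.  Counting with
-- |a + b| = |a| + |b| - 2|a ∧ b| and translation invariance of the total,
-- both X(3d+s) and X(d+s) + 2X(s) equal X(s) + 2|f₀ + f₁|.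

{-# OPTIONS --safe #-}
module Submission where

open import Defs
open import Data.Nat as ℕ using (ℕ; zero; suc; _+_; _*_; _^_; _<_; _≤_; s≤s)
import Data.Nat.Properties as ℕₚ
import Data.Nat.Tactic.RingSolver as ℕ-Solver
open import Data.Integer as ℤ using (ℤ; +_; -[1+_]; -_; ∣_∣)
import Data.Integer.Properties as ℤₚ
import Data.Integer.Tactic.RingSolver as ℤ-Solver
open import Data.Bool using (Bool; true; false; _xor_; _∧_)
open import Data.Bool.Properties
  using (xor-∧-commutativeRing; xor-same; xor-assoc; xor-identityʳ; ∧-distribˡ-xor; ∧-distribʳ-xor)
open import Algebra.Bundles using (CommutativeRing)
import Algebra.Solver.CommutativeMonoid as CommutativeMonoidSolver
open import Data.Product using (_×_; _,_)
open import Relation.Nullary using (contradiction)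
open import Relation.Nullary.Decidable using (yes; no; True; toWitness)
open import Relation.Binary.PropositionalEquality
open ≡-Reasoning

private
  module XorSolver =
    CommutativeMonoidSolver (CommutativeRing.+-commutativeMonoid xor-∧-commutativeRing)

xor-cancelˡ : ∀ x y → x xor x xor y ≡ y
xor-cancelˡ x y = trans (sym (xor-assoc x x y)) (cong (_xor y) (xor-same x))

xor₃-cong : ∀ {a a′ b b′ c c′} → a ≡ a′ → b ≡ b′ → c ≡ c′ → a xor b xor c ≡ a′ xor b′ xor c′
xor₃-cong refl refl refl = refl

xor-doubling : ∀ a b c e g →
  (a xor b xor c) xor (b xor c xor e) xor (c xor e xor g) ≡ a xor c xor g
xor-doubling a b c e g = begin
  (a xor b xor c) xor (b xor c xor e) xor (c xor e xor g)
    ≡⟨ solve 5 (λ a b c e g → (a ⊕ b ⊕ c) ⊕ (b ⊕ c ⊕ e) ⊕ (c ⊕ e ⊕ g)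
                            ⊜ b ⊕ b ⊕ c ⊕ c ⊕ e ⊕ e ⊕ (a ⊕ c ⊕ g)) refl a b c e g ⟩
  b xor b xor c xor c xor e xor e xor (a xor c xor g)
    ≡⟨ xor-cancelˡ b _ ⟩
  c xor c xor e xor e xor (a xor c xor g)
    ≡⟨ xor-cancelˡ c _ ⟩
  e xor e xor (a xor c xor g)
    ≡⟨ xor-cancelˡ e _ ⟩
  a xor c xor g
    ∎
  where open XorSolver

xor-telescope : ∀ a b c e g h i →
  (a xor b xor c) xor (c xor e xor g) xor (g xor h xor i) ≡ (a xor b) xor e xor (h xor i)
xor-telescope a b c e g h i = begin
  (a xor b xor c) xor (c xor e xor g) xor (g xor h xor i)
    ≡⟨ solve 7 (λ a b c e g h i → (a ⊕ b ⊕ c) ⊕ (c ⊕ e ⊕ g) ⊕ (g ⊕ h ⊕ i)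
                                ⊜ c ⊕ c ⊕ g ⊕ g ⊕ ((a ⊕ b) ⊕ e ⊕ (h ⊕ i))) refl a b c e g h i ⟩
  c xor c xor g xor g xor ((a xor b) xor e xor (h xor i))
    ≡⟨ xor-cancelˡ c _ ⟩
  g xor g xor ((a xor b) xor e xor (h xor i))
    ≡⟨ xor-cancelˡ g _ ⟩
  (a xor b) xor e xor (h xor i)
    ∎
  where open XorSolver

bit-xor : ∀ a b → bit (a xor b) + 2 * bit (a ∧ b) ≡ bit a + bit b
bit-xor false false = refl
bit-xor false true  = refl
bit-xor true  false = refl
bit-xor true  true  = refl

bit-xor-disjoint : ∀ a b → a ∧ b ≡ false → bit (a xor b) ≡ bit a + bit b
bit-xor-disjoint a b a∧b≡false = begin
  bit (a xor b)                       ≡⟨ sym (ℕₚ.+-identityʳ _) ⟩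
  bit (a xor b) + 2 * bit false       ≡⟨ cong (λ x → bit (a xor b) + 2 * bit x) (sym a∧b≡false) ⟩
  bit (a xor b) + 2 * bit (a ∧ b)     ≡⟨ bit-xor a b ⟩
  bit a + bit b                       ∎

infixr 5 _⊕_
infixr 6 _⊓_

_⊕_ : (ℤ → Bool) → (ℤ → Bool) → ℤ → Bool
(g ⊕ h) n = g n xor h n

_⊓_ : (ℤ → Bool) → (ℤ → Bool) → ℤ → Bool
(g ⊓ h) n = g n ∧ h n

Disjoint : (ℤ → Bool) → (ℤ → Bool) → Set
Disjoint g h = ∀ n → g n ∧ h n ≡ false

module _ {g h k : ℤ → Bool} where

  Disjoint-⊕ˡ : Disjoint g k → Disjoint h k → Disjoint (g ⊕ h) k
  Disjoint-⊕ˡ g⊥k h⊥k n = trans (∧-distribʳ-xor (k n) (g n) (h n)) (cong₂ _xor_ (g⊥k n) (h⊥k n))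

  Disjoint-⊕ʳ : Disjoint g h → Disjoint g k → Disjoint g (h ⊕ k)
  Disjoint-⊕ʳ g⊥h g⊥k n = trans (∧-distribˡ-xor (g n) (h n) (k n)) (cong₂ _xor_ (g⊥h n) (g⊥k n))

  ⊓-⊕-disjoint : Disjoint g k → ∀ n → (g ⊓ (h ⊕ k)) n ≡ (g ⊓ h) n
  ⊓-⊕-disjoint g⊥k n = begin
    g n ∧ (h n xor k n)             ≡⟨ ∧-distribˡ-xor (g n) (h n) (k n) ⟩
    (g n ∧ h n) xor (g n ∧ k n)     ≡⟨ cong ((g n ∧ h n) xor_) (g⊥k n) ⟩
    (g n ∧ h n) xor false           ≡⟨ xor-identityʳ _ ⟩
    g n ∧ h n                       ∎

-- Rule 150 and the freshman's dream

spread : ℤ → (ℤ → Bool) → ℤ → Bool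
spread e g n = g (n ℤ.- e) xor g n xor g (n ℤ.+ e)

spread-cong : ∀ {e g h} → (∀ n → g n ≡ h n) → ∀ n → spread e g n ≡ spread e h n
spread-cong g≡h n = xor₃-cong (g≡h _) (g≡h n) (g≡h _)

private
  sub-sub : ∀ n e → n ℤ.- e ℤ.- e ≡ n ℤ.- (e ℤ.+ e)
  sub-sub = ℤ-Solver.solve-∀
  sub-add : ∀ n e → n ℤ.- e ℤ.+ e ≡ n
  sub-add = ℤ-Solver.solve-∀
  add-sub : ∀ n e → n ℤ.+ e ℤ.- e ≡ n
  add-sub = ℤ-Solver.solve-∀
  add-add : ∀ n e → n ℤ.+ e ℤ.+ e ≡ n ℤ.+ (e ℤ.+ e)
  add-add = ℤ-Solver.solve-∀

spread-spread : ∀ e g n → spread e (spread e g) n ≡ spread (e ℤ.+ e) g n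
spread-spread e g n
  rewrite sub-sub n e | sub-add n e | add-sub n e | add-add n e
  = xor-doubling (g (n ℤ.- (e ℤ.+ e))) (g (n ℤ.- e)) (g n) (g (n ℤ.+ e)) (g (n ℤ.+ (e ℤ.+ e)))

cell[2^k+t] : ∀ k t n → cell (2 ^ k + t) n ≡ spread (+ (2 ^ k)) (cell t) n
cell[2^k+t] zero    t n = refl
cell[2^k+t] (suc k) t n = begin
  cell (2 ^ suc k + t) n
    ≡⟨ cong (λ u → cell u n) (ℕₚ.+-assoc (2 ^ k) (2 ^ k + 0) t) ⟩
  cell (2 ^ k + ((2 ^ k + 0) + t)) n
    ≡⟨ cong (λ u → cell (2 ^ k + (u + t)) n) (ℕₚ.+-identityʳ (2 ^ k)) ⟩
  cell (2 ^ k + (2 ^ k + t)) n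
    ≡⟨ cell[2^k+t] k (2 ^ k + t) n ⟩
  spread (+ (2 ^ k)) (cell (2 ^ k + t)) n
    ≡⟨ spread-cong (cell[2^k+t] k t) n ⟩
  spread (+ (2 ^ k)) (spread (+ (2 ^ k)) (cell t)) n
    ≡⟨ spread-spread (+ (2 ^ k)) (cell t) n ⟩
  spread (+ (2 ^ k + 2 ^ k)) (cell t) n
    ≡⟨ cong (λ u → spread (+ (2 ^ k + u)) (cell t) n) (sym (ℕₚ.+-identityʳ (2 ^ k))) ⟩
  spread (+ (2 ^ suc k)) (cell t) n
    ∎

-- The light cone of the seed

∣n∣≤∣e∣+∣n+e∣ : ∀ n e → ∣ n ∣ ≤ ∣ e ∣ + ∣ n ℤ.+ e ∣
∣n∣≤∣e∣+∣n+e∣ n e =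
  subst₂ _≤_ (cong ∣_∣ (add-sub n e)) (ℕₚ.+-comm ∣ n ℤ.+ e ∣ ∣ e ∣) (ℤₚ.∣i-j∣≤∣i∣+∣j∣ (n ℤ.+ e) e)

∣e∣+r<∣n∣⇒r<∣n+e∣ : ∀ {r} n e → ∣ e ∣ + r < ∣ n ∣ → r < ∣ n ℤ.+ e ∣
∣e∣+r<∣n∣⇒r<∣n+e∣ n e e+r<∣n∣ = ℕₚ.+-cancelˡ-< ∣ e ∣ _ _ (ℕₚ.<-≤-trans e+r<∣n∣ (∣n∣≤∣e∣+∣n+e∣ n e))

cell-outside : ∀ t n → t < ∣ n ∣ → cell t n ≡ false
cell-outside zero n 0<∣n∣ with n ℤ.≟ + 0
... | yes refl = contradiction 0<∣n∣ (ℕₚ.<-irrefl refl)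
... | no _     = refl
cell-outside (suc t) n 1+t<∣n∣
  rewrite cell-outside t (n ℤ.- + 1) (∣e∣+r<∣n∣⇒r<∣n+e∣ n (- + 1) 1+t<∣n∣)
        | cell-outside t n (ℕₚ.<-trans (ℕₚ.n<1+n t) 1+t<∣n∣)
        | cell-outside t (n ℤ.+ + 1) (∣e∣+r<∣n∣⇒r<∣n+e∣ n (+ 1) 1+t<∣n∣)
  = refl

cell-inside : ∀ t n → cell t n ≡ true → ∣ n ∣ ≤ t
cell-inside t n live = ℕₚ.≮⇒≥ λ t<∣n∣ → contradiction (trans (sym live) (cell-outside t n t<∣n∣)) λ ()

cell-apart : ∀ t a k → 2 * t < k → cell t a ∧ cell t (a ℤ.+ + k) ≡ false
cell-apart t a k 2t<k with cell t a in live-a | cell t (a ℤ.+ + k) in live-b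
... | false | _     = refl
... | true  | false = refl
... | true  | true  = contradiction k≤2t (ℕₚ.<⇒≱ 2t<k)
  where
  k≤2t : k ≤ 2 * t
  k≤2t = subst₂ _≤_ ∣a+k-a∣≡k t+t≡2t
    (ℕₚ.≤-trans (ℤₚ.∣i-j∣≤∣i∣+∣j∣ (a ℤ.+ + k) a)
                (ℕₚ.+-mono-≤ (cell-inside t _ live-b) (cell-inside t a live-a)))
    where
    ∣a+k-a∣≡k : ∣ a ℤ.+ + k ℤ.- a ∣ ≡ k
    ∣a+k-a∣≡k = cong ∣_∣ (trans (cong (ℤ._- a) (ℤₚ.+-comm a (+ k))) (add-sub (+ k) a))
    t+t≡2t : t + t ≡ 2 * t
    t+t≡2t = cong (_+_ t) (sym (ℕₚ.+-identityʳ t))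

sumAround : ℕ → (ℤ → ℕ) → ℕ
sumAround zero    g = g (+ 0)
sumAround (suc r) g = g -[1+ r ] + sumAround r g + g (+ suc r)

Supported : ℕ → (ℤ → ℕ) → Set
Supported r g = ∀ n → r < ∣ n ∣ → g n ≡ 0

Supported-translate : ∀ {r g} → Supported r g → ∀ e → Supported (∣ e ∣ + r) (λ n → g (n ℤ.+ e))
Supported-translate g-supp e n e+r<∣n∣ = g-supp (n ℤ.+ e) (∣e∣+r<∣n∣⇒r<∣n+e∣ n e e+r<∣n∣)

Supported-reflect : ∀ {r g} → Supported r g → Supported r (λ n → g (- n))
Supported-reflect {r} g-supp n r<∣n∣ = g-supp (- n) (subst (r <_) (sym (ℤₚ.∣-i∣≡∣i∣ n)) r<∣n∣)

sumAround-cong : ∀ {g h} → (∀ n → g n ≡ h n) → ∀ r → sumAround r g ≡ sumAround r h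
sumAround-cong g≡h zero    = g≡h (+ 0)
sumAround-cong g≡h (suc r) = cong₂ _+_ (cong₂ _+_ (g≡h _) (sumAround-cong g≡h r)) (g≡h _)

sumAround-+ : ∀ g h r → sumAround r (λ n → g n + h n) ≡ sumAround r g + sumAround r h
sumAround-+ g h zero    = refl
sumAround-+ g h (suc r) rewrite sumAround-+ g h r =
  interchange (g -[1+ r ]) (h -[1+ r ]) (sumAround r g) (sumAround r h) (g (+ suc r)) (h (+ suc r))
  where
  interchange : ∀ a b c d e f → a + b + (c + d) + (e + f) ≡ a + c + e + (b + d + f)
  interchange = ℕ-Solver.solve-∀

sumAround-*ˡ : ∀ k g r → sumAround r (λ n → k * g n) ≡ k * sumAround r g
sumAround-*ˡ k g zero    = refl
sumAround-*ˡ k g (suc r) rewrite sumAround-*ˡ k g r =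
  distrib k (g -[1+ r ]) (sumAround r g) (g (+ suc r))
  where
  distrib : ∀ k a b c → k * a + k * b + k * c ≡ k * (a + b + c)
  distrib = ℕ-Solver.solve-∀

sumAround-reflect : ∀ g r → sumAround r (λ n → g (- n)) ≡ sumAround r g
sumAround-reflect g zero    = refl
sumAround-reflect g (suc r) rewrite sumAround-reflect g r =
  swap-ends (g (+ suc r)) (sumAround r g) (g -[1+ r ])
  where
  swap-ends : ∀ a b c → a + b + c ≡ c + b + a
  swap-ends = ℕ-Solver.solve-∀

sumAround-extend : ∀ {r w g} → Supported r g → r ≤ w → sumAround w g ≡ sumAround r g
sumAround-extend {r} {w} {g} g-supp r≤w with ℕₚ.m≤n⇒∃[o]m+o≡n r≤w
... | k , refl = pad k
  where
  pad : ∀ k → sumAround (r + k) g ≡ sumAround r g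
  pad zero    = cong (λ w → sumAround w g) (ℕₚ.+-identityʳ r)
  pad (suc k) rewrite ℕₚ.+-suc r k
                    | g-supp -[1+ r + k ] (s≤s (ℕₚ.m≤m+n r k))
                    | g-supp (+ suc (r + k)) (s≤s (ℕₚ.m≤m+n r k))
                    | pad k
    = ℕₚ.+-identityʳ (sumAround r g)

sumAround-telescope : ∀ g r → sumAround r (λ n → g (n ℤ.+ + 1)) + g (- + r) ≡ sumAround r g + g (+ suc r)
sumAround-telescope g zero    = ℕₚ.+-comm (g (+ 1)) (g (+ 0))
sumAround-telescope g (suc r) = begin
  g (-[1+ r ] ℤ.+ + 1) + S′ + g (+ suc r ℤ.+ + 1) + g -[1+ r ]
    ≡⟨ cong₂ (λ x y → g x + S′ + g (+ y) + g -[1+ r ])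
             (-[1+r]+1≡-r (+ r)) (ℕₚ.+-comm (suc r) 1) ⟩
  g (- + r) + S′ + g (+ suc (suc r)) + g -[1+ r ]
    ≡⟨ cong (λ x → x + g (+ suc (suc r)) + g -[1+ r ]) (ℕₚ.+-comm (g (- + r)) S′) ⟩
  S′ + g (- + r) + g (+ suc (suc r)) + g -[1+ r ]
    ≡⟨ cong (λ x → x + g (+ suc (suc r)) + g -[1+ r ]) (sumAround-telescope g r) ⟩
  S + g (+ suc r) + g (+ suc (suc r)) + g -[1+ r ]
    ≡⟨ rotate S (g (+ suc r)) (g (+ suc (suc r))) (g -[1+ r ]) ⟩
  g -[1+ r ] + S + g (+ suc r) + g (+ suc (suc r))
    ∎
  where
  S S′ : ℕ
  S  = sumAround r g
  S′ = sumAround r (λ n → g (n ℤ.+ + 1))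
  -[1+r]+1≡-r : ∀ r → - (+ 1 ℤ.+ r) ℤ.+ + 1 ≡ - r
  -[1+r]+1≡-r = ℤ-Solver.solve-∀
  rotate : ∀ a b c d → a + b + c + d ≡ d + a + b + c
  rotate = ℕ-Solver.solve-∀

sumAround-translate₁ : ∀ {r w g} → Supported r g → r < w →
  sumAround w (λ n → g (n ℤ.+ + 1)) ≡ sumAround w g
sumAround-translate₁ {r} {w} {g} g-supp r<w = ℕₚ.+-cancelʳ-≡ 0 _ _ (begin
  sumAround w (λ n → g (n ℤ.+ + 1)) + 0
    ≡⟨ cong (_+_ (sumAround w (λ n → g (n ℤ.+ + 1)))) (sym left-end) ⟩
  sumAround w (λ n → g (n ℤ.+ + 1)) + g (- + w)
    ≡⟨ sumAround-telescope g w ⟩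
  sumAround w g + g (+ suc w)
    ≡⟨ cong (_+_ (sumAround w g)) (g-supp (+ suc w) (ℕₚ.m<n⇒m<1+n r<w)) ⟩
  sumAround w g + 0
    ∎)
  where
  left-end : g (- + w) ≡ 0
  left-end = g-supp (- + w) (subst (r <_) (sym (ℤₚ.∣-i∣≡∣i∣ (+ w))) r<w)

sumAround-translate⁺ : ∀ {r w g} → Supported r g → ∀ k → k + r ≤ w →
  sumAround w (λ n → g (n ℤ.+ + k)) ≡ sumAround w g
sumAround-translate⁺ {w = w} {g} g-supp zero    _ =
  sumAround-cong (λ n → cong g (ℤₚ.+-identityʳ n)) w
sumAround-translate⁺ {w = w} {g} g-supp (suc k) k+r<w = begin
  sumAround w (λ n → g (n ℤ.+ + suc k))
    ≡⟨ sumAround-cong (λ n → cong g (sym (ℤₚ.+-assoc n (+ 1) (+ k)))) w ⟩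
  sumAround w (λ n → g (n ℤ.+ + 1 ℤ.+ + k))
    ≡⟨ sumAround-translate₁ (Supported-translate g-supp (+ k)) k+r<w ⟩
  sumAround w (λ n → g (n ℤ.+ + k))
    ≡⟨ sumAround-translate⁺ g-supp k (ℕₚ.<⇒≤ k+r<w) ⟩
  sumAround w g
    ∎

sumAround-translate : ∀ {r w g} → Supported r g → ∀ e → ∣ e ∣ + r ≤ w →
  sumAround w (λ n → g (n ℤ.+ e)) ≡ sumAround w g
sumAround-translate g-supp (+ k) = sumAround-translate⁺ g-supp k
sumAround-translate {w = w} {g} g-supp -[1+ k ] 1+k+r≤w = begin
  sumAround w (λ n → g (n ℤ.+ -[1+ k ]))
    ≡⟨ sumAround-reflect (λ n → g (n ℤ.+ -[1+ k ])) w ⟨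
  sumAround w (λ n → g (- n ℤ.+ -[1+ k ]))
    ≡⟨ sumAround-cong (λ n → cong g (ℤₚ.neg-distrib-+ n (+ suc k))) w ⟨
  sumAround w (λ n → g (- (n ℤ.+ + suc k)))
    ≡⟨ sumAround-translate⁺ (Supported-reflect g-supp) (suc k) 1+k+r≤w ⟩
  sumAround w (λ n → g (- n))
    ≡⟨ sumAround-reflect g w ⟩
  sumAround w g
    ∎

weight : ℕ → (ℤ → Bool) → ℕ
weight w g = sumAround w (λ n → bit (g n))

weight-cong : ∀ {g h} w → (∀ n → g n ≡ h n) → weight w g ≡ weight w h
weight-cong w g≡h = sumAround-cong (λ n → cong bit (g≡h n)) w

X≡weight : ∀ t → X t ≡ weight t (cell t)
X≡weight t = windowSum≡weight t
  where
  windowSum≡weight : ∀ r → windowSum t r ≡ weight r (cell t)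
  windowSum≡weight zero    = refl
  windowSum≡weight (suc r) =
    cong (λ x → bit (cell t -[1+ r ]) + x + bit (cell t (+ suc r))) (windowSum≡weight r)

cell-supported : ∀ t → Supported t (λ n → bit (cell t n))
cell-supported t n t<∣n∣ = cong bit (cell-outside t n t<∣n∣)

weight-⊕ : ∀ w g h → weight w (g ⊕ h) + 2 * weight w (g ⊓ h) ≡ weight w g + weight w h
weight-⊕ w g h = begin
  weight w (g ⊕ h) + 2 * weight w (g ⊓ h)
    ≡⟨ cong (_+_ (weight w (g ⊕ h))) (sumAround-*ˡ 2 (λ n → bit (g n ∧ h n)) w) ⟨
  weight w (g ⊕ h) + sumAround w (λ n → 2 * bit (g n ∧ h n))
    ≡⟨ sumAround-+ (λ n → bit (g n xor h n)) (λ n → 2 * bit (g n ∧ h n)) w ⟨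
  sumAround w (λ n → bit (g n xor h n) + 2 * bit (g n ∧ h n))
    ≡⟨ sumAround-cong (λ n → bit-xor (g n) (h n)) w ⟩
  sumAround w (λ n → bit (g n) + bit (h n))
    ≡⟨ sumAround-+ (λ n → bit (g n)) (λ n → bit (h n)) w ⟩
  weight w g + weight w h
    ∎

weight-⊕-disjoint : ∀ w {g h} → Disjoint g h → weight w (g ⊕ h) ≡ weight w g + weight w h
weight-⊕-disjoint w {g} {h} g⊥h =
  trans (sumAround-cong (λ n → bit-xor-disjoint (g n) (h n) (g⊥h n)) w)
        (sumAround-+ (λ n → bit (g n)) (λ n → bit (h n)) w)

weight-⊕₃-disjoint : ∀ w {g h k} → Disjoint g h → Disjoint g k → Disjoint h k →
  weight w (g ⊕ h ⊕ k) ≡ weight w g + (weight w h + weight w k)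
weight-⊕₃-disjoint w {g} {h} {k} g⊥h g⊥k h⊥k =
  trans (weight-⊕-disjoint w (Disjoint-⊕ʳ {g} {h} {k} g⊥h g⊥k))
        (cong (_+_ (weight w g)) (weight-⊕-disjoint w h⊥k))

-- The recursion at time 2 ^ (m + 1)

module Doubling (m s : ℕ) (s<2^m : s < 2 ^ m) where

  d : ℕ
  d = 2 ^ m

  D : ℤ
  D = + d

  -- Wide enough for the cells up to time 3d + s and for translates by at most 3d
  -- of configurations living in [-s, s].
  W : ℕ
  W = 3 * d + s

  translate : ℤ → ℤ → Bool
  translate i n = cell s (n ℤ.+ i ℤ.* D)

  overlapping : ℤ → Bool
  overlapping n = cell s n ∧ cell s (n ℤ.+ D)

  translate-+ : ∀ i k n → translate i (n ℤ.+ k ℤ.* D) ≡ translate (i ℤ.+ k) n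
  translate-+ i k n = cong (cell s) (shift n i k D)
    where
    shift : ∀ n i k D → n ℤ.+ k ℤ.* D ℤ.+ i ℤ.* D ≡ n ℤ.+ (i ℤ.+ k) ℤ.* D
    shift = ℤ-Solver.solve-∀

  translate-- : ∀ i k n → translate i (n ℤ.- k ℤ.* D) ≡ translate (i ℤ.- k) n
  translate-- i k n = cong (cell s) (shift n i k D)
    where
    shift : ∀ n i k D → n ℤ.- k ℤ.* D ℤ.+ i ℤ.* D ≡ n ℤ.+ (i ℤ.- k) ℤ.* D
    shift = ℤ-Solver.solve-∀

  spread-translate : ∀ k i n →
    spread (k ℤ.* D) (translate i) n ≡ (translate (i ℤ.- k) ⊕ translate i ⊕ translate (i ℤ.+ k)) n
  spread-translate k i n = cong₂ _xor_ (translate-- i k n) (cong (_xor_ (translate i n)) (translate-+ i k n))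

  cell≡translate₀ : ∀ n → cell s n ≡ translate (+ 0) n
  cell≡translate₀ n = cong (cell s) (no-shift n D)
    where
    no-shift : ∀ n D → n ≡ n ℤ.+ + 0 ℤ.* D
    no-shift = ℤ-Solver.solve-∀

  cell[d+s] : ∀ n → cell (2 ^ m + s) n ≡ (translate (- + 1) ⊕ translate (+ 0) ⊕ translate (+ 1)) n
  cell[d+s] n = begin
    cell (2 ^ m + s) n                      ≡⟨ cell[2^k+t] m s n ⟩
    spread D (cell s) n                     ≡⟨ spread-cong cell≡translate₀ n ⟩
    spread D (translate (+ 0)) n            ≡⟨ cong (λ e → spread e (translate (+ 0)) n) (ℤₚ.*-identityˡ D) ⟨
    spread (+ 1 ℤ.* D) (translate (+ 0)) n  ≡⟨ spread-translate (+ 1) (+ 0) n ⟩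
    (translate (- + 1) ⊕ translate (+ 0) ⊕ translate (+ 1)) n ∎

  cell[2d+s] : ∀ n → cell (2 ^ suc m + s) n ≡ (translate (- + 2) ⊕ translate (+ 0) ⊕ translate (+ 2)) n
  cell[2d+s] n = begin
    cell (2 ^ suc m + s) n                  ≡⟨ cell[2^k+t] (suc m) s n ⟩
    spread (+ (2 * d)) (cell s) n           ≡⟨ spread-cong cell≡translate₀ n ⟩
    spread (+ (2 * d)) (translate (+ 0)) n  ≡⟨ cong (λ e → spread e (translate (+ 0)) n) (ℤₚ.pos-* 2 d) ⟩
    spread (+ 2 ℤ.* D) (translate (+ 0)) n  ≡⟨ spread-translate (+ 2) (+ 0) n ⟩
    (translate (- + 2) ⊕ translate (+ 0) ⊕ translate (+ 2)) n ∎

  cell[3d+s] : ∀ n → cell (2 ^ suc m + 2 ^ m + s) n ≡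
    ((translate (- + 3) ⊕ translate (- + 2)) ⊕ translate (+ 0) ⊕ (translate (+ 2) ⊕ translate (+ 3))) n
  cell[3d+s] n = begin
    cell (2 ^ suc m + d + s) n
      ≡⟨ cong (λ t → cell t n) (ℕₚ.+-assoc (2 ^ suc m) d s) ⟩
    cell (2 ^ suc m + (d + s)) n
      ≡⟨ cell[2^k+t] (suc m) (d + s) n ⟩
    spread (+ (2 * d)) (cell (d + s)) n
      ≡⟨ spread-cong cell[d+s] n ⟩
    spread (+ (2 * d)) middle n
      ≡⟨ cong (λ e → spread e middle n) (ℤₚ.pos-* 2 d) ⟩
    spread (+ 2 ℤ.* D) middle n
      ≡⟨ cong₂ _xor_
           (xor₃-cong (translate-- (- + 1) (+ 2) n) (translate-- (+ 0) (+ 2) n) (translate-- (+ 1) (+ 2) n))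
           (cong (_xor_ (middle n))
             (xor₃-cong (translate-+ (- + 1) (+ 2) n) (translate-+ (+ 0) (+ 2) n) (translate-+ (+ 1) (+ 2) n))) ⟩
    (t (- + 3) xor t (- + 2) xor t (- + 1)) xor
    (t (- + 1) xor t (+ 0) xor t (+ 1)) xor
    (t (+ 1) xor t (+ 2) xor t (+ 3))
      ≡⟨ xor-telescope (t (- + 3)) (t (- + 2)) (t (- + 1)) (t (+ 0)) (t (+ 1)) (t (+ 2)) (t (+ 3)) ⟩
    ((translate (- + 3) ⊕ translate (- + 2)) ⊕ translate (+ 0) ⊕ (translate (+ 2) ⊕ translate (+ 3))) n
      ∎
    where
    middle : ℤ → Bool
    middle = translate (- + 1) ⊕ translate (+ 0) ⊕ translate (+ 1)
    t : ℤ → Bool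
    t i = translate i n

  translate-apart : ∀ i k {_ : True (2 ℕ.≤? k)} → Disjoint (translate i) (translate (i ℤ.+ + k))
  translate-apart i k {2≤k} n =
    subst (λ x → translate i n ∧ cell s x ≡ false) shift (cell-apart s (n ℤ.+ i ℤ.* D) (k * d) 2s<kd)
    where
    shift : n ℤ.+ i ℤ.* D ℤ.+ + (k * d) ≡ n ℤ.+ (i ℤ.+ + k) ℤ.* D
    shift = trans (cong (ℤ._+_ (n ℤ.+ i ℤ.* D)) (ℤₚ.pos-* k d)) (distrib n i (+ k) D)
      where
      distrib : ∀ n i k D → n ℤ.+ i ℤ.* D ℤ.+ k ℤ.* D ≡ n ℤ.+ (i ℤ.+ k) ℤ.* D
      distrib = ℤ-Solver.solve-∀
    2s<kd : 2 * s < k * d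
    2s<kd = ℕₚ.<-≤-trans (ℕₚ.*-monoʳ-< 2 s<2^m) (ℕₚ.*-monoˡ-≤ d (toWitness 2≤k))

  X≡weight-W : ∀ {t} → t ≤ W → X t ≡ weight W (cell t)
  X≡weight-W {t} t≤W = trans (X≡weight t) (sym (sumAround-extend (cell-supported t) t≤W))

  weight-translate : ∀ {g} → Supported s (λ n → bit (g n)) → ∀ i {_ : True (∣ i ∣ ℕ.≤? 3)} →
    weight W (λ n → g (n ℤ.+ i ℤ.* D)) ≡ weight W g
  weight-translate g-supp i {∣i∣≤3} = sumAround-translate g-supp (i ℤ.* D) (ℕₚ.+-monoˡ-≤ s ∣iD∣≤3d)
    where
    ∣iD∣≤3d : ∣ i ℤ.* D ∣ ≤ 3 * d
    ∣iD∣≤3d = subst (_≤ 3 * d) (sym (ℤₚ.abs-* i D)) (ℕₚ.*-monoˡ-≤ d (toWitness ∣i∣≤3))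

  translate-weight : ∀ i {_ : True (∣ i ∣ ℕ.≤? 3)} → weight W (translate i) ≡ X s
  translate-weight i {∣i∣≤3} =
    trans (weight-translate (cell-supported s) i {∣i∣≤3}) (sym (X≡weight-W (ℕₚ.m≤n+m s (3 * d))))

  overlapping-weight : ∀ i {_ : True (∣ i ∣ ℕ.≤? 3)} →
    weight W (translate i ⊓ translate (i ℤ.+ + 1)) ≡ weight W overlapping
  overlapping-weight i {∣i∣≤3} =
    trans (weight-cong W (λ n → cong (λ x → translate i n ∧ cell s x) (shift n i D)))
          (weight-translate overlapping-supported i {∣i∣≤3})
    where
    shift : ∀ n i D → n ℤ.+ (i ℤ.+ + 1) ℤ.* D ≡ n ℤ.+ i ℤ.* D ℤ.+ D
    shift = ℤ-Solver.solve-∀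
    overlapping-supported : Supported s (λ n → bit (overlapping n))
    overlapping-supported n s<∣n∣ rewrite cell-outside s n s<∣n∣ = refl

  pair-weight : ∀ i {_ : True (∣ i ∣ ℕ.≤? 3)} {_ : True (∣ i ℤ.+ + 1 ∣ ℕ.≤? 3)} →
    weight W (translate i ⊕ translate (i ℤ.+ + 1)) + 2 * weight W overlapping ≡ 2 * X s
  pair-weight i {p} {q} = begin
    weight W (f ⊕ f′) + 2 * weight W overlapping
      ≡⟨ cong (λ x → weight W (f ⊕ f′) + 2 * x) (overlapping-weight i {p}) ⟨
    weight W (f ⊕ f′) + 2 * weight W (f ⊓ f′)
      ≡⟨ weight-⊕ W f f′ ⟩
    weight W f + weight W f′
      ≡⟨ cong₂ _+_ (translate-weight i {p}) (translate-weight (i ℤ.+ + 1) {q}) ⟩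
    X s + X s
      ≡⟨ cong (_+_ (X s)) (ℕₚ.+-identityʳ (X s)) ⟨
    2 * X s
      ∎
    where
    f f′ : ℤ → Bool
    f  = translate i
    f′ = translate (i ℤ.+ + 1)

  pair-weight-invariant : ∀ i {_ : True (∣ i ∣ ℕ.≤? 3)} {_ : True (∣ i ℤ.+ + 1 ∣ ℕ.≤? 3)} →
    weight W (translate i ⊕ translate (i ℤ.+ + 1)) ≡ weight W (translate (+ 0) ⊕ translate (+ 1))
  pair-weight-invariant i {p} {q} =
    ℕₚ.+-cancelʳ-≡ (2 * weight W overlapping) _ _
      (trans (pair-weight i {p} {q}) (sym (pair-weight (+ 0))))

  X[2d+s]≡3*X[s] : X (2 ^ suc m + s) ≡ 3 * X s
  X[2d+s]≡3*X[s] = begin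
    X (2 ^ suc m + s)
      ≡⟨ X≡weight-W (ℕₚ.+-monoˡ-≤ s (ℕₚ.*-monoˡ-≤ d (ℕₚ.n≤1+n 2))) ⟩
    weight W (cell (2 ^ suc m + s))
      ≡⟨ weight-cong W cell[2d+s] ⟩
    weight W (translate (- + 2) ⊕ translate (+ 0) ⊕ translate (+ 2))
      ≡⟨ weight-⊕₃-disjoint W (translate-apart (- + 2) 2) (translate-apart (- + 2) 4)
                              (translate-apart (+ 0) 2) ⟩
    weight W (translate (- + 2)) + (weight W (translate (+ 0)) + weight W (translate (+ 2)))
      ≡⟨ cong₂ _+_ (translate-weight (- + 2)) (cong₂ _+_ (translate-weight (+ 0)) (translate-weight (+ 2))) ⟩
    X s + (X s + X s)
      ≡⟨ cong (λ x → X s + (X s + x)) (ℕₚ.+-identityʳ (X s)) ⟨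
    3 * X s
      ∎

  X[d+s]-decomposition : X (2 ^ m + s) + 2 * weight W overlapping ≡
    X s + weight W (translate (+ 0) ⊕ translate (+ 1))
  X[d+s]-decomposition = begin
    X (d + s) + 2 * weight W overlapping
      ≡⟨ cong₂ (λ x y → x + 2 * y) (X≡weight-W (ℕₚ.+-monoˡ-≤ s (ℕₚ.m≤n*m d 3)))
                                   (sym (overlapping-weight (- + 1))) ⟩
    weight W (cell (d + s)) + 2 * weight W (t₋₁ ⊓ t₀)
      ≡⟨ cong₂ (λ x y → x + 2 * y) (weight-cong W cell[d+s])
               (sym (weight-cong W (⊓-⊕-disjoint {t₋₁} {t₀} {t₁} (translate-apart (- + 1) 2)))) ⟩
    weight W (t₋₁ ⊕ t₀ ⊕ t₁) + 2 * weight W (t₋₁ ⊓ (t₀ ⊕ t₁))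
      ≡⟨ weight-⊕ W t₋₁ (t₀ ⊕ t₁) ⟩
    weight W t₋₁ + weight W (t₀ ⊕ t₁)
      ≡⟨ cong (_+ weight W (t₀ ⊕ t₁)) (translate-weight (- + 1)) ⟩
    X s + weight W (t₀ ⊕ t₁)
      ∎
    where
    t₋₁ t₀ t₁ : ℤ → Bool
    t₋₁ = translate (- + 1)
    t₀  = translate (+ 0)
    t₁  = translate (+ 1)

  X[3d+s]-decomposition : X (2 ^ suc m + 2 ^ m + s) ≡
    weight W (translate (- + 3) ⊕ translate (- + 2)) + (X s + weight W (translate (+ 2) ⊕ translate (+ 3)))
  X[3d+s]-decomposition = begin
    X (2 ^ suc m + d + s)
      ≡⟨ X≡weight-W (ℕₚ.≤-reflexive (cong (_+ s) (ℕₚ.+-comm (2 * d) d))) ⟩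
    weight W (cell (2 ^ suc m + d + s))
      ≡⟨ weight-cong W cell[3d+s] ⟩
    weight W ((t₋₃ ⊕ t₋₂) ⊕ t₀ ⊕ (t₂ ⊕ t₃))
      ≡⟨ weight-⊕₃-disjoint W left⊥centre left⊥right centre⊥right ⟩
    weight W (t₋₃ ⊕ t₋₂) + (weight W t₀ + weight W (t₂ ⊕ t₃))
      ≡⟨ cong (λ x → weight W (t₋₃ ⊕ t₋₂) + (x + weight W (t₂ ⊕ t₃))) (translate-weight (+ 0)) ⟩
    weight W (t₋₃ ⊕ t₋₂) + (X s + weight W (t₂ ⊕ t₃))
      ∎
    where
    t₋₃ t₋₂ t₀ t₂ t₃ : ℤ → Bool
    t₋₃ = translate (- + 3)
    t₋₂ = translate (- + 2)
    t₀  = translate (+ 0)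
    t₂  = translate (+ 2)
    t₃  = translate (+ 3)
    left⊥centre : Disjoint (t₋₃ ⊕ t₋₂) t₀
    left⊥centre = Disjoint-⊕ˡ {t₋₃} {t₋₂} {t₀} (translate-apart (- + 3) 3) (translate-apart (- + 2) 2)
    left⊥right : Disjoint (t₋₃ ⊕ t₋₂) (t₂ ⊕ t₃)
    left⊥right =
      Disjoint-⊕ˡ {t₋₃} {t₋₂} {t₂ ⊕ t₃}
        (Disjoint-⊕ʳ {t₋₃} {t₂} {t₃} (translate-apart (- + 3) 5) (translate-apart (- + 3) 6))
        (Disjoint-⊕ʳ {t₋₂} {t₂} {t₃} (translate-apart (- + 2) 4) (translate-apart (- + 2) 5))
    centre⊥right : Disjoint t₀ (t₂ ⊕ t₃)
    centre⊥right = Disjoint-⊕ʳ {t₀} {t₂} {t₃} (translate-apart (+ 0) 2) (translate-apart (+ 0) 3)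

  X[3d+s]≡X[d+s]+2*X[s] : X (2 ^ suc m + 2 ^ m + s) ≡ X (2 ^ m + s) + 2 * X s
  X[3d+s]≡X[d+s]+2*X[s] = begin
    X (2 ^ suc m + d + s)
      ≡⟨ X[3d+s]-decomposition ⟩
    weight W (translate (- + 3) ⊕ translate (- + 2)) + (X s + weight W (translate (+ 2) ⊕ translate (+ 3)))
      ≡⟨ cong₂ (λ x y → x + (X s + y)) (pair-weight-invariant (- + 3)) (pair-weight-invariant (+ 2)) ⟩
    P + (X s + P)
      ≡⟨ ℕₚ.+-comm P (X s + P) ⟩
    X s + P + P
      ≡⟨ cong (_+ P) X[d+s]-decomposition ⟨
    X (d + s) + 2 * O + P
      ≡⟨ ℕₚ.+-assoc (X (d + s)) (2 * O) P ⟩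
    X (d + s) + (2 * O + P)
      ≡⟨ cong (_+_ (X (d + s))) (trans (ℕₚ.+-comm (2 * O) P) (pair-weight (+ 0))) ⟩
    X (d + s) + 2 * X s
      ∎
    where
    P O : ℕ
    P = weight W (translate (+ 0) ⊕ translate (+ 1))
    O = weight W overlapping

mainTheorem1 : (m s : ℕ) → s < 2 ^ m →
    (X (2 ^ suc m + s) ≡ 3 * X s)
    × (X (2 ^ suc m + 2 ^ m + s) ≡ X (2 ^ m + s) + 2 * X s)
mainTheorem1 m s s<2^m = X[2d+s]≡3*X[s] , X[3d+s]≡X[d+s]+2*X[s]
  where open Doubling m s s<2^m
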